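{- Let $S=\langle d_0,d_1,d_2,d_3\rangle$ be a numerical semigroup with embedding dimension four. Then there is an arrangement $\{i,j,k,l\}=\{0,1,2,3\}$ such that either $a_{mm}=b_{i,mm}$ for at least two distinct indices $m\in\{j,k,l\}$, or $a_{ii}d_i=a_{jj}d_j$ and $a_{kk}d_k=a_{ll}d_l$.
   Context: $S$ is the set of nonnegative integer combinations of its minimal generators $d_0,\dots,d_3$ ($\gcd=1$). For $m\in\{0,1,2,3\}$, $a_{mm}$ is the least positive integer such that $a_{mm}d_m=\sum_{n\ne m}a_{mn}d_n$ for some $a_{mn}\in\mathbb N$. For distinct $i,m$, $b_{i,mm}$ is the least positive integer such that $b_{i,mm}d_m=\sum_{n\ne m}c_nd_n$ for some $c_n\in\mathbb N$ with $c_i>0$ (the coefficient of $d_m$ in the $d_i$-positive minimal relation of $d_m$). -}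

module Defs where

open import Data.Nat using (ℕ; zero; suc; _+_; _*_; _<_)
open import Data.Nat.GCD using (gcd)
open import Data.Fin using (Fin)
open import Data.Product using (Σ; _×_; _,_)
open import Relation.Binary.PropositionalEquality using (_≡_; _≢_)
open import Relation.Nullary using (¬_)

Gens : Set
Gens = Fin 4 → ℕ

comb : (Fin 4 → ℕ) → Gens → ℕ
comb c d = c (# 0) * d (# 0) + c (# 1) * d (# 1) + c (# 2) * d (# 2) + c (# 3) * d (# 3)
  where open import Data.Fin using (#_)

-- x = Σ_{n ≠ m} c n d n for some c ∈ ℕ^4 (c m = 0 encodes the omission of n = m),
-- optionally with an extra requirement on c.
ReprWithout : Gens → Fin 4 → ℕ → ((Fin 4 → ℕ) → Set) → Set
ReprWithout d m x P = Σ (Fin 4 → ℕ) λ c → c m ≡ 0 × P c × x ≡ comb c d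

Trivial : (Fin 4 → ℕ) → Set
Trivial _ = Fin 1

GcdOne : Gens → Set
GcdOne d = gcd (gcd (gcd (d (# 0)) (d (# 1))) (d (# 2))) (d (# 3)) ≡ 1
  where open import Data.Fin using (#_)

MinimalGens : Gens → Set
MinimalGens d = (m : Fin 4) → ¬ ReprWithout d m (d m) Trivial

EmbDim4 : Gens → Set
EmbDim4 d = GcdOne d × MinimalGens d

IsLeast : Gens → Fin 4 → ((Fin 4 → ℕ) → Set) → ℕ → Set
IsLeast d m P a =
  0 < a × ReprWithout d m (a * d m) P
        × ((a' : ℕ) → 0 < a' → a' < a → ¬ ReprWithout d m (a' * d m) P)

IsAmm : Gens → Fin 4 → ℕ → Set
IsAmm d m a = IsLeast d m Trivial a

IsBimm : Gens → Fin 4 → Fin 4 → ℕ → Set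
IsBimm d i m b = IsLeast d m (λ c → 0 < c i) b

Arrangement : Fin 4 → Fin 4 → Fin 4 → Fin 4 → Set
Arrangement i j k l =
  i ≢ j × i ≢ k × i ≢ l × j ≢ k × j ≢ l × k ≢ l

-- Fix for every m a relation a_mm d_m = Σ c_mn d_n (c_mm = 0) and let σ m be an index with
-- c_{m,σm} > 0. Such a relation is d_{σm}-positive, so minimality of both a_mm and b_{σm,mm}
-- forces a_mm = b_{σm,mm}. Suppose no i has two distinct m, m' ≠ i with a_mm = b_{i,mm} and
-- a_m'm' = b_{i,m'm'}. Then σ is injective, hence a permutation; every chosen relation involves
-- d_{σm} alone; σ is an involution without fixed points; and a_mm d_m = a_nn d_n for n = σ m.
-- The two σ-orbits {0, σ 0} and {k, σ k} then give the second alternative.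
module Submission where

open import Defs
open import Data.Nat using (ℕ; _*_)
open import Data.Fin using (Fin)
open import Data.Product using (Σ; _×_)
open import Data.Sum using (_⊎_)
open import Relation.Binary.PropositionalEquality using (_≡_; _≢_)

open import Data.Empty using (⊥; ⊥-elim)
open import Data.Fin using (zero; suc; #_; punchOut)
open import Data.Fin.Properties using (_≟_; any?; all?; punchOut-injective; <⇒notInjective)
open import Data.Nat using (_+_; _∸_; _≤_; _<_; _<?_)
import Data.Nat as Nat
open import Data.Nat.Properties
  using (≤-antisym; ≤-trans; ≮⇒≥; <-irrefl; n≤0⇒n≡0; n≢0⇒n>0; n<1+n; *-mono-<; *-monoˡ-≤;
         *-distribʳ-+; m∸n+n≡m; m≤n+m; +-identityʳ; module ≤-Reasoning)
open import Data.Nat.Tactic.RingSolver using (solve-∀)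
open import Data.Product using (∃; _,_; proj₁; proj₂)
open import Data.Sum using (inj₁; inj₂)
open import Function using (_∘_; case_of_)
open import Function.Definitions using (Injective)
open import Relation.Nullary using (¬_; Dec; yes; no)
open import Relation.Nullary.Decidable using (_×-dec_; ¬?)
open import Relation.Binary.PropositionalEquality
  using (refl; sym; trans; cong; cong₂; subst; ≢-sym; module ≡-Reasoning)

injective⇒surjective : ∀ {n} {f : Fin n → Fin n} → Injective _≡_ _≡_ f → ∀ y → ∃ λ x → f x ≡ y
injective⇒surjective {Nat.suc n} {f} f-injective y with any? (λ x → f x ≟ y)
... | yes hit = hit
... | no miss = ⊥-elim (<⇒notInjective {f = punchOut ∘ avoids} (n<1+n n)
                  (λ {x} {x'} → f-injective ∘ punchOut-injective (avoids x) (avoids x')))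
  where
  avoids : ∀ x → y ≢ f x
  avoids x e = miss (x , sym e)

missing-value : ∀ {n} (g : Fin n → Fin (Nat.suc n)) → ∃ λ y → ∀ x → g x ≢ y
missing-value {n} g with any? (λ y → all? (λ x → ¬? (g x ≟ y)))
... | yes found = found
... | no ¬found = ⊥-elim (<⇒notInjective {f = preimage} (n<1+n n) preimage-injective)
  where
  preimage-of : ∀ y → ∃ λ x → g x ≡ y
  preimage-of y with any? (λ x → g x ≟ y)
  ... | yes hit = hit
  ... | no miss = ⊥-elim (¬found (y , λ x e → miss (x , e)))

  preimage : Fin (Nat.suc n) → Fin n
  preimage = proj₁ ∘ preimage-of

  preimage-injective : Injective _≡_ _≡_ preimage
  preimage-injective {y} {y'} e =
    trans (sym (proj₂ (preimage-of y))) (trans (cong g e) (proj₂ (preimage-of y')))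

avoid₃ : (i j k : Fin 4) → ∃ λ l → i ≢ l × j ≢ l × k ≢ l
avoid₃ i j k =
  let l , ∉ = missing-value (λ { zero → i ; (suc zero) → j ; (suc (suc zero)) → k })
  in l , ∉ (# 0) , ∉ (# 1) , ∉ (# 2)

involution-arrangement : (σ : Fin 4 → Fin 4) → (∀ m → σ m ≢ m) → (∀ m → σ (σ m) ≡ m) →
                         ∃ λ k → Arrangement zero (σ zero) k (σ k)
involution-arrangement σ no-fix involutive =
  let k , 0≢k , σ0≢k , _ = avoid₃ zero (σ zero) (σ zero)
  in k , ≢-sym (no-fix zero) , 0≢k
       , (λ 0≡σk → σ0≢k (trans (cong σ 0≡σk) (involutive k)))
       , σ0≢k
       , (λ σ0≡σk → 0≢k (trans (sym (involutive zero)) (trans (cong σ σ0≡σk) (involutive k))))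
       , ≢-sym (no-fix k)

single : ∀ {n} → Fin n → ℕ → Fin n → ℕ
single m x k with k ≟ m
... | yes _ = x
... | no _ = 0

single-at : ∀ {n} (m : Fin n) x → single m x m ≡ x
single-at m x with m ≟ m
... | yes _ = refl
... | no m≢m = ⊥-elim (m≢m refl)

single-off : ∀ {n} (m : Fin n) x k → k ≢ m → single m x k ≡ 0
single-off m x k k≢m with k ≟ m
... | yes k≡m = ⊥-elim (k≢m k≡m)
... | no _ = refl

module _ (d : Gens) where

  comb-supported : (v : Fin 4 → ℕ) (n : Fin 4) → (∀ k → k ≢ n → v k ≡ 0) → comb v d ≡ v n * d n
  comb-supported v zero off rewrite off (# 1) (λ ()) | off (# 2) (λ ()) | off (# 3) (λ ()) =
    trans (+-identityʳ _) (trans (+-identityʳ _) (+-identityʳ _))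
  comb-supported v (suc zero) off rewrite off (# 0) (λ ()) | off (# 2) (λ ()) | off (# 3) (λ ()) =
    trans (+-identityʳ _) (+-identityʳ _)
  comb-supported v (suc (suc zero)) off rewrite off (# 0) (λ ()) | off (# 1) (λ ()) | off (# 3) (λ ()) =
    +-identityʳ _
  comb-supported v (suc (suc (suc zero))) off rewrite off (# 0) (λ ()) | off (# 1) (λ ()) | off (# 2) (λ ()) =
    refl

  comb-single : ∀ m x → comb (single m x) d ≡ x * d m
  comb-single m x = trans (comb-supported (single m x) m (single-off m x)) (cong (_* d m) (single-at m x))

  comb-+ : (u v : Fin 4 → ℕ) → comb (λ k → u k + v k) d ≡ comb u d + comb v d
  comb-+ u v = distrib (u (# 0)) (u (# 1)) (u (# 2)) (u (# 3)) (v (# 0)) (v (# 1)) (v (# 2)) (v (# 3))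
                       (d (# 0)) (d (# 1)) (d (# 2)) (d (# 3))
    where
    distrib : ∀ a b c e f g h i x y z w →
      (a + f) * x + (b + g) * y + (c + h) * z + (e + i) * w ≡
      (a * x + b * y + c * z + e * w) + (f * x + g * y + h * z + i * w)
    distrib = solve-∀

  comb-pos⇒coeff-pos : (v : Fin 4 → ℕ) → 0 < comb v d → ∃ λ n → 0 < v n
  comb-pos⇒coeff-pos v pos with any? (λ n → 0 <? v n)
  ... | yes found = found
  ... | no none = ⊥-elim (<-irrefl (sym vanishes) pos)
    where
    zero-coeff : ∀ n → v n ≡ 0
    zero-coeff n = n≤0⇒n≡0 (≮⇒≥ (λ p → none (n , p)))

    vanishes : comb v d ≡ 0
    vanishes = trans (comb-supported v zero (λ k _ → zero-coeff k)) (cong (_* d zero) (zero-coeff zero))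

IsLeast⇒≤ : ∀ (d : Gens) {m P a a'} → IsLeast d m P a → 0 < a' → ReprWithout d m (a' * d m) P → a ≤ a'
IsLeast⇒≤ d {a' = a'} (_ , _ , below-least) a'-pos r = ≮⇒≥ (λ a'<a → below-least a' a'-pos a'<a r)

Amm≡Bimm : ∀ (d : Gens) {i m a b} → IsAmm d m a → IsBimm d i m b →
           ReprWithout d m (a * d m) (λ c → 0 < c i) → a ≡ b
Amm≡Bimm d isA@(a-pos , _) isB@(b-pos , (c , c-m , _ , eq) , _) r =
  ≤-antisym (IsLeast⇒≤ d isA b-pos (c , c-m , zero , eq)) (IsLeast⇒≤ d isB a-pos r)

Amm≤ : ∀ (d : Gens) {m n a c x} → IsAmm d n a → n ≢ m → 0 < c → c * d n ≡ x * d m → a ≤ c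
Amm≤ d {m} {n} {x = x} isA n≢m c-pos eq =
  IsLeast⇒≤ d isA c-pos (single m x , single-off m x n n≢m , zero , trans eq (sym (comb-single d m x)))

module MinimalRelations (d : Gens) (emb : EmbDim4 d)
    (A : Fin 4 → ℕ) (isA : (m : Fin 4) → IsAmm d m (A m))
    (B : Fin 4 → Fin 4 → ℕ) (isB : (i m : Fin 4) → i ≢ m → IsBimm d i m (B i m)) where

  Conclusion : Set
  Conclusion = Σ (Fin 4) λ i → Σ (Fin 4) λ j → Σ (Fin 4) λ k → Σ (Fin 4) λ l →
    Arrangement i j k l ×
    (((A j ≡ B i j × A k ≡ B i k) ⊎ (A j ≡ B i j × A l ≡ B i l) ⊎ (A k ≡ B i k × A l ≡ B i l))
     ⊎ (A i * d i ≡ A j * d j × A k * d k ≡ A l * d l))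

  Collision : Set
  Collision = ∃ λ i → ∃ λ m → ∃ λ m' → m ≢ m' × m ≢ i × m' ≢ i × A m ≡ B i m × A m' ≡ B i m'

  collision? : Dec Collision
  collision? = any? λ i → any? λ m → any? λ m' →
    ¬? (m ≟ m') ×-dec ¬? (m ≟ i) ×-dec ¬? (m' ≟ i) ×-dec (A m Nat.≟ B i m) ×-dec (A m' Nat.≟ B i m')

  collision⇒conclusion : Collision → Conclusion
  collision⇒conclusion (i , m , m' , m≢m' , m≢i , m'≢i , eq , eq') =
    let l , i≢l , m≢l , m'≢l = avoid₃ i m m'
    in i , m , m' , l , (≢-sym m≢i , ≢-sym m'≢i , i≢l , m≢m' , m≢l , m'≢l) , inj₁ (inj₁ (eq , eq'))

  -- Only the minimality half of EmbDim4 is ever used.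
  d-pos : ∀ m → 0 < d m
  d-pos m = n≢0⇒n>0 (λ d-m≡0 → proj₂ emb m ((λ _ → 0) , refl , zero , d-m≡0))

  coeff : Fin 4 → Fin 4 → ℕ
  coeff m = proj₁ (proj₁ (proj₂ (isA m)))

  coeff-self : ∀ m → coeff m m ≡ 0
  coeff-self m = proj₁ (proj₂ (proj₁ (proj₂ (isA m))))

  coeff-eq : ∀ m → A m * d m ≡ comb (coeff m) d
  coeff-eq m = proj₂ (proj₂ (proj₂ (proj₁ (proj₂ (isA m)))))

  A≡B-of-relation : ∀ {m i} (v : Fin 4 → ℕ) → v m ≡ 0 → 0 < v i → A m * d m ≡ comb v d → A m ≡ B i m
  A≡B-of-relation {m} {i} v v-m v-i eq = Amm≡Bimm d (isA m) (isB i m i≢m) (v , v-m , v-i , eq)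
    where
    i≢m : i ≢ m
    i≢m refl = <-irrefl (sym v-m) v-i

  -- Opaque so that typechecking never unfolds the search performed by comb-pos⇒coeff-pos.
  opaque
    σ-spec : ∀ m → ∃ λ n → 0 < coeff m n
    σ-spec m = comb-pos⇒coeff-pos d (coeff m) (subst (0 <_) (coeff-eq m) (*-mono-< (proj₁ (isA m)) (d-pos m)))

  σ : Fin 4 → Fin 4
  σ = proj₁ ∘ σ-spec

  σ-pos : ∀ m → 0 < coeff m (σ m)
  σ-pos = proj₂ ∘ σ-spec

  σ-no-fix : ∀ m → σ m ≢ m
  σ-no-fix m σm≡m = <-irrefl (sym (coeff-self m)) (subst (λ n → 0 < coeff m n) σm≡m (σ-pos m))

  A≡B-σ : ∀ m → A m ≡ B (σ m) m
  A≡B-σ m = A≡B-of-relation (coeff m) (coeff-self m) (σ-pos m) (coeff-eq m)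

  module NoCollision (¬collision : ¬ Collision) where

    ¬collide : ∀ {i m m'} → m ≢ m' → m ≢ i → m' ≢ i → A m ≡ B i m → A m' ≡ B i m' → ⊥
    ¬collide {i} {m} {m'} m≢m' m≢i m'≢i t t' = ¬collision (i , m , m' , m≢m' , m≢i , m'≢i , t , t')

    σ-injective : Injective _≡_ _≡_ σ
    σ-injective {m} {m'} σm≡σm' with m ≟ m'
    ... | yes m≡m' = m≡m'
    ... | no m≢m' = ⊥-elim (¬collide m≢m' (λ m≡σm' → σ-no-fix m (trans σm≡σm' (sym m≡σm')))
                      (σ-no-fix m' ∘ sym) (subst (λ i → A m ≡ B i m) σm≡σm' (A≡B-σ m)) (A≡B-σ m'))

    σ⁻¹ : Fin 4 → Fin 4
    σ⁻¹ = proj₁ ∘ injective⇒surjective σ-injective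

    σ-σ⁻¹ : ∀ k → σ (σ⁻¹ k) ≡ k
    σ-σ⁻¹ = proj₂ ∘ injective⇒surjective σ-injective

    coeff-pos⇒σ : ∀ {m k} → 0 < coeff m k → k ≡ σ m
    coeff-pos⇒σ {m} {k} k-pos with k ≟ σ m
    ... | yes k≡σm = k≡σm
    ... | no k≢σm = ⊥-elim (¬collide m≢t m≢k t≢k
                      (A≡B-of-relation (coeff m) (coeff-self m) k-pos (coeff-eq m))
                      (subst (λ i → A t ≡ B i t) σt≡k (A≡B-σ t)))
      where
      t = σ⁻¹ k
      σt≡k = σ-σ⁻¹ k
      m≢t : m ≢ t
      m≢t refl = k≢σm (sym σt≡k)
      m≢k : m ≢ k
      m≢k refl = <-irrefl (sym (coeff-self m)) k-pos
      t≢k : t ≢ k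
      t≢k t≡k = σ-no-fix t (trans σt≡k (sym t≡k))

    coeff-off-σ : ∀ m k → k ≢ σ m → coeff m k ≡ 0
    coeff-off-σ m k k≢σm = n≤0⇒n≡0 (≮⇒≥ (k≢σm ∘ coeff-pos⇒σ))

    A-d-σ : ∀ m → A m * d m ≡ coeff m (σ m) * d (σ m)
    A-d-σ m = trans (coeff-eq m) (comb-supported d (coeff m) (σ m) (coeff-off-σ m))

    A-σ-≤ : ∀ m → A (σ m) ≤ coeff m (σ m)
    A-σ-≤ m = Amm≤ d {x = A m} (isA (σ m)) (σ-no-fix m) (σ-pos m) (sym (A-d-σ m))

    -- If σ (σ m) ≠ m, substituting the relation of n = σ m into a_mm d_m = (c - a_nn) d_n + a_nn d_n
    -- yields a d_{σn}-positive relation for d_m, so m and n collide at σ n.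
    σ-involutive : ∀ m → σ (σ m) ≡ m
    σ-involutive m with σ (σ m) ≟ m
    ... | yes σn≡m = σn≡m
    ... | no σn≢m = ⊥-elim (¬collide (σ-no-fix m ∘ sym) (≢-sym σn≢m) (≢-sym (σ-no-fix n))
                      (A≡B-of-relation w w-m w-σn A-d-as-w) (A≡B-σ n))
      where
      n = σ m
      surplus = coeff m n ∸ A n

      w : Fin 4 → ℕ
      w k = single n surplus k + coeff n k

      w-m : w m ≡ 0
      w-m = cong₂ _+_ (single-off n surplus m (σ-no-fix m ∘ sym)) (coeff-off-σ n m (≢-sym σn≢m))

      w-σn : 0 < w (σ n)
      w-σn = ≤-trans (σ-pos n) (m≤n+m _ _)

      A-d-as-w : A m * d m ≡ comb w d
      A-d-as-w = begin
        A m * d m                                     ≡⟨ A-d-σ m ⟩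
        coeff m n * d n                               ≡⟨ cong (_* d n) (sym (m∸n+n≡m (A-σ-≤ m))) ⟩
        (surplus + A n) * d n                         ≡⟨ *-distribʳ-+ (d n) surplus (A n) ⟩
        surplus * d n + A n * d n                     ≡⟨ cong₂ _+_ (sym (comb-single d n surplus)) (coeff-eq n) ⟩
        comb (single n surplus) d + comb (coeff n) d  ≡⟨ sym (comb-+ d (single n surplus) (coeff n)) ⟩
        comb w d                                      ∎
        where open ≡-Reasoning

    A-d-σ-≤ : ∀ m → A (σ m) * d (σ m) ≤ A m * d m
    A-d-σ-≤ m = begin
      A (σ m) * d (σ m)        ≤⟨ *-monoˡ-≤ (d (σ m)) (A-σ-≤ m) ⟩
      coeff m (σ m) * d (σ m)  ≡⟨ A-d-σ m ⟨
      A m * d m                ∎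
      where open ≤-Reasoning

    σ-balanced : ∀ m → A m * d m ≡ A (σ m) * d (σ m)
    σ-balanced m = ≤-antisym
      (subst (λ k → A k * d k ≤ A (σ m) * d (σ m)) (σ-involutive m) (A-d-σ-≤ (σ m)))
      (A-d-σ-≤ m)

    conclusion : Conclusion
    conclusion =
      let k , arrangement = involution-arrangement σ σ-no-fix σ-involutive
      in zero , σ zero , k , σ k , arrangement , inj₂ (σ-balanced zero , σ-balanced k)

lemma2p7 : (d : Fin 4 → ℕ) → EmbDim4 d →
    (A : Fin 4 → ℕ) → ((m : Fin 4) → IsAmm d m (A m)) →
    (B : Fin 4 → Fin 4 → ℕ) → ((i m : Fin 4) → i ≢ m → IsBimm d i m (B i m)) →
    Σ (Fin 4) λ i → Σ (Fin 4) λ j → Σ (Fin 4) λ k → Σ (Fin 4) λ l →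
    Arrangement i j k l ×
    (((A j ≡ B i j × A k ≡ B i k) ⊎ (A j ≡ B i j × A l ≡ B i l) ⊎ (A k ≡ B i k × A l ≡ B i l))
    ⊎ (A i * d i ≡ A j * d j × A k * d k ≡ A l * d l))
lemma2p7 d emb A isA B isB = case collision? of λ where
    (yes collision) → collision⇒conclusion collision
    (no ¬collision) → NoCollision.conclusion ¬collision
  where open MinimalRelations d emb A isA B isB
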